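{- No tree in the family $\mathcal{T}$ is $(1,2,2)$-colorable.
   Context: For a graph $G$ and a positive integer $d$, a $d$-packing is a set of vertices at pairwise distance greater than $d$. A graph $G$ is $(1,2,2)$-colorable if $V(G)$ can be partitioned into three (possibly empty) sets $X_1,X_2,X_3$ where $X_1$ is an independent set and $X_2,X_3$ are $2$-packings. Let $T_0$ be the tree consisting of a path $p_0p_1p_2p_3p_4$ together with three leaves attached to $p_1$, $p_2$ and $p_3$ respectively. Let $T_1$ be the tree consisting of a path $p_0p_1\cdots p_7$ together with four leaves attached to $p_1$, $p_2$, $p_5$ and $p_6$ respectively. The family $\mathcal{T}$ is defined recursively: (i) $T_0,T_1\in\mathcal{T}$; (ii) if $T\in\mathcal{T}$ and $uv$ is an edge of $T$ with both $u$ and $v$ of degree $2$, then the tree obtained from $T$ by removing $uv$, adding four new vertices $u_1,u_2,u_3,w$ and the edges $uu_1,u_1u_2,u_2u_3,u_3v,u_2w$ belongs to $\mathcal{T}$. -}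

module Defs where

open import Data.Nat using (ℕ; zero; suc; _+_; _≤_)
open import Data.Fin using (Fin; splitAt) renaming (zero to f0)
import Data.Fin as F
open import Data.Sum using (_⊎_; inj₁; inj₂)
open import Data.Product using (Σ; _×_; _,_; ∃)
open import Data.Empty using (⊥)
open import Relation.Nullary using (¬_)
open import Relation.Binary.PropositionalEquality using (_≡_; _≢_)
open import Level using (0ℓ)

record Graph : Set₁ where
  field
    n   : ℕ
    Adj : Fin n → Fin n → Set
open Graph public

data Walk (G : Graph) : Fin (n G) → Fin (n G) → ℕ → Set where
  here : ∀ {a} → Walk G a a 0
  step : ∀ {a b c k} → Adj G a b → Walk G b c k → Walk G a c (suc k)

DistLE : (G : Graph) → ℕ → Fin (n G) → Fin (n G) → Set
DistLE G d a b = Σ ℕ (λ k → k ≤ d × Walk G a b k)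

Independent : (G : Graph) → (Fin (n G) → Set) → Set
Independent G X = ∀ a b → X a → X b → ¬ Adj G a b

Packing : (G : Graph) → ℕ → (Fin (n G) → Set) → Set
Packing G d X = ∀ a b → X a → X b → a ≢ b → ¬ DistLE G d a b

-- (1,2,2)-colorable: partition V(G) into X₁ (class 0), X₂ (class 1), X₃ (class 2)
Colorable122 : Graph → Set
Colorable122 G = Σ (Fin (n G) → Fin 3) λ c →
  Independent G (λ x → c x ≡ F.zero)
  × Packing G 2 (λ x → c x ≡ F.suc F.zero)
  × Packing G 2 (λ x → c x ≡ F.suc (F.suc F.zero))

Deg2 : (G : Graph) → Fin (n G) → Set
Deg2 G u = Σ (Fin (n G)) λ a → Σ (Fin (n G)) λ b →
  a ≢ b × Adj G u a × Adj G u b × (∀ c → Adj G u c → c ≡ a ⊎ c ≡ b)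

Sym : ∀ {A : Set} → (A → A → Set) → A → A → Set
Sym E a b = E a b ⊎ E b a

-- T0: path p0..p4 = 0..4, leaves 5,6,7 attached to p1,p2,p3
data E₀ : Fin 8 → Fin 8 → Set where
  e01 : E₀ (F.# 0) (F.# 1)
  e12 : E₀ (F.# 1) (F.# 2)
  e23 : E₀ (F.# 2) (F.# 3)
  e34 : E₀ (F.# 3) (F.# 4)
  e15 : E₀ (F.# 1) (F.# 5)
  e26 : E₀ (F.# 2) (F.# 6)
  e37 : E₀ (F.# 3) (F.# 7)

T₀ : Graph
T₀ = record { n = 8 ; Adj = Sym E₀ }

-- T1: path p0..p7 = 0..7, leaves 8,9,10,11 attached to p1,p2,p5,p6
data E₁ : Fin 12 → Fin 12 → Set where
  e01 : E₁ (F.# 0) (F.# 1)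
  e12 : E₁ (F.# 1) (F.# 2)
  e23 : E₁ (F.# 2) (F.# 3)
  e34 : E₁ (F.# 3) (F.# 4)
  e45 : E₁ (F.# 4) (F.# 5)
  e56 : E₁ (F.# 5) (F.# 6)
  e67 : E₁ (F.# 6) (F.# 7)
  e18 : E₁ (F.# 1) (F.# 8)
  e29 : E₁ (F.# 2) (F.# 9)
  e510 : E₁ (F.# 5) (F.# 10)
  e611 : E₁ (F.# 6) (F.# 11)

T₁ : Graph
T₁ = record { n = 12 ; Adj = Sym E₁ }

-- The operation (ii): remove uv, add u1,u2,u3,w (new vertices 0,1,2,3 of Fin 4)
-- and edges u u1, u1 u2, u2 u3, u3 v, u2 w.
data NewE {m : ℕ} (u v : Fin m) : Fin m ⊎ Fin 4 → Fin m ⊎ Fin 4 → Set where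
  uu1  : NewE u v (inj₁ u) (inj₂ (F.# 0))
  u1u2 : NewE u v (inj₂ (F.# 0)) (inj₂ (F.# 1))
  u2u3 : NewE u v (inj₂ (F.# 1)) (inj₂ (F.# 2))
  u3v  : NewE u v (inj₂ (F.# 2)) (inj₁ v)
  u2w  : NewE u v (inj₂ (F.# 1)) (inj₂ (F.# 3))

OldKept : (G : Graph) → Fin (n G) → Fin (n G) → Fin (n G) ⊎ Fin 4 → Fin (n G) ⊎ Fin 4 → Set
OldKept G u v (inj₁ a) (inj₁ b) = Adj G a b × ¬ (a ≡ u × b ≡ v) × ¬ (a ≡ v × b ≡ u)
OldKept G u v _ _ = ⊥

Expand : (G : Graph) → Fin (n G) → Fin (n G) → Graph
Expand G u v = record
  { n = n G + 4
  ; Adj = λ x y → OldKept G u v (splitAt (n G) x) (splitAt (n G) y)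
                  ⊎ Sym (NewE u v) (splitAt (n G) x) (splitAt (n G) y) }

record _≅_ (G H : Graph) : Set where
  field
    to      : Fin (n G) → Fin (n H)
    from    : Fin (n H) → Fin (n G)
    from-to : ∀ a → from (to a) ≡ a
    to-from : ∀ b → to (from b) ≡ b
    adj-to  : ∀ a b → Adj G a b → Adj H (to a) (to b)
    adj-from : ∀ a b → Adj H (to a) (to b) → Adj G a b

-- The family 𝒯 (closed under isomorphism, since trees are considered up to isomorphism)
data InT : Graph → Set₁ where
  t0  : InT T₀
  t1  : InT T₁
  ext : ∀ {G} (u v : Fin (n G)) → InT G → Adj G u v → Deg2 G u → Deg2 G v → InT (Expand G u v)
  iso : ∀ {G H} → InT G → G ≅ H → InT H

-- Call a graph admissible if it is simple and, whenever adjacent vertices p and q both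
-- have degree 2, every other neighbour of p has degree at least 3.  T₀ and T₁ are
-- admissible, and so is every expansion of an admissible graph: the new path
-- u u₁ u₂ u₃ v has the degree-3 vertex u₂ in its middle, and the other neighbours a of u
-- and b of v already had degree at least 3.
--
-- In a (1,2,2)-colouring a vertex with three neighbours never gets colour 0, for then
-- its neighbours would be three pairwise-near vertices sharing the two packing colours.
-- This kills T₀ (p₁, p₂, p₃ are pairwise near) and T₁ (the adjacent p₃ and p₄ are both
-- forced into class 0).  In an expansion, the same argument at u₂ gives c(v) = c(u₁) ≠ 0
-- when c(u) = 0, and otherwise c(u) = c(u₃) (if c(v) = 0) or c(u) = c(v).  In the first
-- case the colouring restricts to G; in the second it does after recolouring v with 0,
-- which is legal because b has degree at least 3 and hence a non-zero colour.  So
-- uncolourability is inherited along the whole family.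

module Submission where

open import Defs
open import Data.Nat using (s≤s; z≤n)
open import Data.Fin using (Fin; #_; join; splitAt) renaming (zero to f0; suc to fs)
open import Data.Fin.Properties using (_≟_; splitAt-join; join-splitAt)
open import Data.Sum using (_⊎_; inj₁; inj₂; swap; map; [_,_]′)
open import Data.Sum.Properties using (inj₁-injective)
open import Data.Product using (Σ; _×_; _,_; -,_; proj₁; proj₂)
open import Data.Empty using (⊥; ⊥-elim)
open import Function using (_∘_; _∋_)
open import Relation.Nullary using (¬_; yes; no)
open import Relation.Nullary.Decidable using (decidable-stable)
open import Relation.Binary.PropositionalEquality
  using (_≡_; _≢_; refl; sym; trans; cong; subst; subst₂)

module _ {V : Set} (A : V → V → Set) where

  Near : V → V → Set
  Near x y = A x y ⊎ Σ V λ m → A x m × A m y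

  Degree2 : V → Set
  Degree2 x = Σ V λ a → Σ V λ b →
    a ≢ b × A x a × A x b × (∀ c → A x c → c ≡ a ⊎ c ≡ b)

  record Claw (x y₁ y₂ y₃ : V) : Set where
    constructor claw
    field
      edge₁ : A x y₁
      edge₂ : A x y₂
      edge₃ : A x y₃
      y₁≢y₂ : y₁ ≢ y₂
      y₁≢y₃ : y₁ ≢ y₃
      y₂≢y₃ : y₂ ≢ y₃

  Degree≥3 : V → Set
  Degree≥3 x = Σ V λ y₁ → Σ V λ y₂ → Σ V λ y₃ → Claw x y₁ y₂ y₃

  record IsSimple : Set where
    field
      symmetric   : ∀ {x y} → A x y → A y x
      irreflexive : ∀ {x} → ¬ A x x

    adjacent⇒≢ : ∀ {x y} → A x y → x ≢ y
    adjacent⇒≢ e refl = irreflexive e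

  BranchingAt : V → V → Set
  BranchingAt p q = Degree2 p → Degree2 q → ∀ r → A p r → r ≢ q → Degree≥3 r

  Branching : Set
  Branching = ∀ {p q} → A p q → BranchingAt p q

  record Admissible : Set where
    field
      isSimple  : IsSimple
      branching : Branching

  record OtherNeighbour (x y : V) : Set where
    field
      vertex   : V
      vertex≢  : vertex ≢ y
      adjacent : A x vertex
      only     : ∀ c → A x c → c ≡ vertex ⊎ c ≡ y

module _ {V : Set} {A : V → V → Set} where

  near-sym : (∀ {x y} → A x y → A y x) → ∀ {x y} → Near A x y → Near A y x
  near-sym sym-A (inj₁ e)            = inj₁ (sym-A e)
  near-sym sym-A (inj₂ (m , xm , my)) = inj₂ (m , sym-A my , sym-A xm)

  degree≥3⇒¬degree2 : ∀ {x} → Degree≥3 A x → ¬ Degree2 A x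
  degree≥3⇒¬degree2 (y₁ , y₂ , y₃ , claw e₁ e₂ e₃ d₁₂ d₁₃ d₂₃) (_ , _ , _ , _ , _ , only)
    with only y₁ e₁ | only y₂ e₂ | only y₃ e₃
  ... | inj₁ p | inj₁ q | _      = d₁₂ (trans p (sym q))
  ... | inj₂ p | inj₂ q | _      = d₁₂ (trans p (sym q))
  ... | inj₁ p | inj₂ q | inj₁ r = d₁₃ (trans p (sym r))
  ... | inj₁ p | inj₂ q | inj₂ r = d₂₃ (trans q (sym r))
  ... | inj₂ p | inj₁ q | inj₂ r = d₁₃ (trans p (sym r))
  ... | inj₂ p | inj₁ q | inj₁ r = d₂₃ (trans q (sym r))

  other-neighbour : ∀ {x y} → Degree2 A x → A x y → OtherNeighbour A x y
  other-neighbour {y = y} (α , β , α≢β , xα , xβ , only) xy with only y xy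
  ... | inj₁ refl =
    record { vertex = β ; vertex≢ = α≢β ∘ sym ; adjacent = xβ ; only = λ c → swap ∘ only c }
  ... | inj₂ refl =
    record { vertex = α ; vertex≢ = α≢β ; adjacent = xα ; only = only }

  branchingAt-degree≥3-end : ∀ {p q} → Degree≥3 A p ⊎ Degree≥3 A q →
                             BranchingAt A p q × BranchingAt A q p
  branchingAt-degree≥3-end (inj₁ p≥3) = (λ dp _ → ⊥-elim (degree≥3⇒¬degree2 p≥3 dp))
                            , (λ _ dp → ⊥-elim (degree≥3⇒¬degree2 p≥3 dp))
  branchingAt-degree≥3-end (inj₂ q≥3) = (λ _ dq → ⊥-elim (degree≥3⇒¬degree2 q≥3 dq))
                            , (λ dq _ → ⊥-elim (degree≥3⇒¬degree2 q≥3 dq))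

  branchingAt-beside-degree≥3 : ∀ {p s t} → (∀ {x} → A p x → x ≡ s ⊎ x ≡ t) → Degree≥3 A t →
                                ∀ {q} → A p q → BranchingAt A p q
  branchingAt-beside-degree≥3 nbrs t≥3 pq _ dq _ pr r≢q with nbrs pq | nbrs pr
  ... | inj₂ refl | _         = ⊥-elim (degree≥3⇒¬degree2 t≥3 dq)
  ... | inj₁ refl | inj₂ refl = t≥3
  ... | inj₁ refl | inj₁ refl = ⊥-elim (r≢q refl)

module _ {V : Set} {E : V → V → Set} where

  Sym-isSimple : (∀ {x} → ¬ E x x) → IsSimple (Sym E)
  Sym-isSimple irr =
    record { symmetric = swap ; irreflexive = λ { (inj₁ e) → irr e ; (inj₂ e) → irr e } }

  Sym-branching : (∀ {p q} → E p q → BranchingAt (Sym E) p q × BranchingAt (Sym E) q p) →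
                  Branching (Sym E)
  Sym-branching edge (inj₁ e) = proj₁ (edge e)
  Sym-branching edge (inj₂ e) = proj₂ (edge e)

-- Colour 0 is the independent class X₁, colours 1 and 2 the two 2-packings:
-- distinct vertices at distance ≤ 2 may share a colour only if it is 0.
Compatible : Fin 3 → Fin 3 → Set
Compatible p q = p ≡ q → p ≡ f0

compatible-sym : ∀ {p q} → Compatible p q → Compatible q p
compatible-sym ok q≡p = trans q≡p (ok (sym q≡p))

nonzero-pigeonhole : ∀ {p q r : Fin 3} → p ≢ f0 → q ≢ f0 → r ≢ f0 → p ≢ q → q ≢ r → p ≡ r
nonzero-pigeonhole {f0} p≢0 _ _ _ _ = ⊥-elim (p≢0 refl)
nonzero-pigeonhole {_} {f0} _ q≢0 _ _ _ = ⊥-elim (q≢0 refl)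
nonzero-pigeonhole {_} {_} {f0} _ _ r≢0 _ _ = ⊥-elim (r≢0 refl)
nonzero-pigeonhole {fs f0} {fs f0} _ _ _ p≢q _ = ⊥-elim (p≢q refl)
nonzero-pigeonhole {fs (fs f0)} {fs (fs f0)} _ _ _ p≢q _ = ⊥-elim (p≢q refl)
nonzero-pigeonhole {_} {fs f0} {fs f0} _ _ _ _ q≢r = ⊥-elim (q≢r refl)
nonzero-pigeonhole {_} {fs (fs f0)} {fs (fs f0)} _ _ _ _ q≢r = ⊥-elim (q≢r refl)
nonzero-pigeonhole {fs f0} {fs (fs f0)} {fs f0} _ _ _ _ _ = refl
nonzero-pigeonhole {fs (fs f0)} {fs f0} {fs (fs f0)} _ _ _ _ _ = refl

record ValidColouring {V : Set} (A : V → V → Set) (c : V → Fin 3) : Set where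
  field
    independent : ∀ {x y} → A x y → c x ≡ f0 → c y ≡ f0 → ⊥
    packing     : ∀ {x y} → x ≢ y → Near A x y → Compatible (c x) (c y)

Colouring : ∀ {V : Set} → (V → V → Set) → Set
Colouring {V} A = Σ (V → Fin 3) (ValidColouring A)

module ColouringFacts {V : Set} {A : V → V → Set} (simple : IsSimple A)
                      {c : V → Fin 3} (valid : ValidColouring A c) where
  open IsSimple simple
  open ValidColouring valid

  near-colours-differ : ∀ {x y} → x ≢ y → Near A x y → c x ≢ f0 → c x ≢ c y
  near-colours-differ x≢y n cx≢0 cx≡cy = cx≢0 (packing x≢y n cx≡cy)

  no-nonzero-triangle : ∀ {x y z} → x ≢ y → y ≢ z → x ≢ z →
    Near A x y → Near A y z → Near A x z → c x ≢ f0 → c y ≢ f0 → c z ≢ f0 → ⊥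
  no-nonzero-triangle x≢y y≢z x≢z xy yz xz cx≢0 cy≢0 cz≢0 =
    near-colours-differ x≢z xz cx≢0
      (nonzero-pigeonhole cx≢0 cy≢0 cz≢0
        (near-colours-differ x≢y xy cx≢0) (near-colours-differ y≢z yz cy≢0))

  legs-near : ∀ {x y z} → A x y → A x z → Near A y z
  legs-near xy xz = inj₂ (_ , symmetric xy , xz)

  centre-nonzero : ∀ {x y₁ y₂ y₃} → Claw A x y₁ y₂ y₃ → c x ≢ f0
  centre-nonzero (claw e₁ e₂ e₃ d₁₂ d₁₃ d₂₃) cx≡0 =
    no-nonzero-triangle d₁₂ d₂₃ d₁₃ (legs-near e₁ e₂) (legs-near e₂ e₃) (legs-near e₁ e₃)
      (independent e₁ cx≡0) (independent e₂ cx≡0) (independent e₃ cx≡0)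

  leg-zero : ∀ {x y₁ y₂ y₃} → Claw A x y₁ y₂ y₃ → c y₁ ≢ f0 → c y₂ ≡ f0
  leg-zero {y₂ = y₂} cl@(claw e₁ e₂ _ d₁₂ _ _) cy₁≢0 =
    decidable-stable (c y₂ ≟ f0) λ cy₂≢0 →
      no-nonzero-triangle (adjacent⇒≢ e₁) d₁₂ (adjacent⇒≢ e₂)
        (inj₁ e₁) (legs-near e₁ e₂) (inj₁ e₂) (centre-nonzero cl) cy₁≢0 cy₂≢0

  opposite-of-zero : ∀ {m y y′ z x x′} → Claw A m y y′ z → A x y → A x′ y′ → x′ ≢ m →
                     c x ≡ f0 → c x′ ≡ c y × c x′ ≢ f0
  opposite-of-zero {y = y} {x′ = x′} cl@(claw my my′ _ _ _ _) xy x′y′ x′≢m cx≡0 =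
    nonzero-pigeonhole cx′≢0 (centre-nonzero cl) cy≢0
      (near-colours-differ x′≢m (inj₂ (_ , x′y′ , symmetric my′)) cx′≢0)
      (near-colours-differ (adjacent⇒≢ my) (inj₁ my) (centre-nonzero cl))
    , cx′≢0
    where
    cy≢0 : c y ≢ f0
    cy≢0 = independent xy cx≡0
    cx′≢0 : c x′ ≢ f0
    cx′≢0 cx′≡0 = independent x′y′ cx′≡0 (leg-zero cl cy≢0)

  opposite-of-nonzero : ∀ {m y y′ z x x′} → Claw A m y y′ z → A x y → A x′ y′ →
                        x ≢ m → x′ ≢ m → c x ≢ f0 → c x′ ≢ f0 → c x ≡ c x′
  opposite-of-nonzero cl@(claw my my′ _ _ _ _) xy x′y′ x≢m x′≢m cx≢0 cx′≢0 =
    nonzero-pigeonhole cx≢0 (centre-nonzero cl) cx′≢0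
      (near-colours-differ x≢m (inj₂ (_ , xy , symmetric my)) cx≢0)
      (λ cm≡cx′ → near-colours-differ x′≢m (inj₂ (_ , x′y′ , symmetric my′)) cx′≢0
                    (sym cm≡cx′))

record RelIso {V W : Set} (A : V → V → Set) (B : W → W → Set) : Set where
  field
    to       : V → W
    from     : W → V
    from-to  : ∀ x → from (to x) ≡ x
    to-from  : ∀ y → to (from y) ≡ y
    to-adj   : ∀ {x y} → A x y → B (to x) (to y)
    from-adj : ∀ {x y} → B x y → A (from x) (from y)

≅⇒RelIso : ∀ {G H} → G ≅ H → RelIso (Adj G) (Adj H)
≅⇒RelIso {H = H} φ = record
  { to = to ; from = from ; from-to = from-to ; to-from = to-from
  ; to-adj = λ {x} {y} → adj-to x y
  ; from-adj = λ {x} {y} e → adj-from _ _ (subst₂ (Adj H) (sym (to-from x)) (sym (to-from y)) e) }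
  where open _≅_ φ

module _ {V W : Set} {A : V → V → Set} {B : W → W → Set} (φ : RelIso A B) where
  open RelIso φ

  to-injective : ∀ {x y} → to x ≡ to y → x ≡ y
  to-injective {x} {y} e = trans (sym (from-to x)) (trans (cong from e) (from-to y))

  from-injective : ∀ {x y} → from x ≡ from y → x ≡ y
  from-injective {x} {y} e = trans (sym (to-from x)) (trans (cong to e) (to-from y))

  to-adj-from : ∀ {y x} → A (from y) x → B y (to x)
  to-adj-from {y} e = subst (λ t → B t _) (to-from y) (to-adj e)

  degree2-from : ∀ {y} → Degree2 B y → Degree2 A (from y)
  degree2-from (α , β , α≢β , yα , yβ , only) =
    from α , from β , α≢β ∘ from-injective , from-adj yα , from-adj yβ , only′
    where
    only′ : ∀ c → A _ c → c ≡ from α ⊎ c ≡ from β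
    only′ c e with only (to c) (to-adj-from e)
    ... | inj₁ p = inj₁ (trans (sym (from-to c)) (cong from p))
    ... | inj₂ p = inj₂ (trans (sym (from-to c)) (cong from p))

  degree≥3-to : ∀ {x} → Degree≥3 A x → Degree≥3 B (to x)
  degree≥3-to (y₁ , y₂ , y₃ , claw e₁ e₂ e₃ d₁₂ d₁₃ d₂₃) =
    to y₁ , to y₂ , to y₃ , claw (to-adj e₁) (to-adj e₂) (to-adj e₃)
      (d₁₂ ∘ to-injective) (d₁₃ ∘ to-injective) (d₂₃ ∘ to-injective)

  transport-admissible : Admissible A → Admissible B
  transport-admissible adm = record
    { isSimple = record
      { symmetric = λ e → subst₂ B (to-from _) (to-from _) (to-adj (symmetric (from-adj e)))
      ; irreflexive = irreflexive ∘ from-adj }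
    ; branching = λ pq dp dq r pr r≢q →
        subst (Degree≥3 B) (to-from r)
          (degree≥3-to (branching (from-adj pq) (degree2-from dp) (degree2-from dq)
                          (from r) (from-adj pr) (r≢q ∘ from-injective))) }
    where open Admissible adm
          open IsSimple isSimple

  transport-uncolourable : ¬ Colouring A → ¬ Colouring B
  transport-uncolourable uncol (c , valid) = uncol (c ∘ to , record
    { independent = independent ∘ to-adj
    ; packing = λ x≢y → packing (x≢y ∘ to-injective) ∘ near-to })
    where
    open ValidColouring valid
    near-to : ∀ {x y} → Near A x y → Near B (to x) (to y)
    near-to (inj₁ e)            = inj₁ (to-adj e)
    near-to (inj₂ (m , xm , my)) = inj₂ (to m , to-adj xm , to-adj my)

simple₀ : IsSimple (Sym E₀)
simple₀ = Sym-isSimple λ ()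

claw₀-1 : Claw (Sym E₀) (# 1) (# 0) (# 2) (# 5)
claw₀-1 = claw (inj₂ e01) (inj₁ e12) (inj₁ e15) (λ ()) (λ ()) (λ ())

claw₀-2 : Claw (Sym E₀) (# 2) (# 1) (# 3) (# 6)
claw₀-2 = claw (inj₂ e12) (inj₁ e23) (inj₁ e26) (λ ()) (λ ()) (λ ())

claw₀-3 : Claw (Sym E₀) (# 3) (# 2) (# 4) (# 7)
claw₀-3 = claw (inj₂ e23) (inj₁ e34) (inj₁ e37) (λ ()) (λ ()) (λ ())

branching₀ : ∀ {p q} → E₀ p q → BranchingAt (Sym E₀) p q × BranchingAt (Sym E₀) q p
branching₀ e01 = branchingAt-degree≥3-end (inj₂ (-, -, -, claw₀-1))
branching₀ e12 = branchingAt-degree≥3-end (inj₁ (-, -, -, claw₀-1))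
branching₀ e23 = branchingAt-degree≥3-end (inj₁ (-, -, -, claw₀-2))
branching₀ e34 = branchingAt-degree≥3-end (inj₁ (-, -, -, claw₀-3))
branching₀ e15 = branchingAt-degree≥3-end (inj₁ (-, -, -, claw₀-1))
branching₀ e26 = branchingAt-degree≥3-end (inj₁ (-, -, -, claw₀-2))
branching₀ e37 = branchingAt-degree≥3-end (inj₁ (-, -, -, claw₀-3))

admissible₀ : Admissible (Sym E₀)
admissible₀ = record { isSimple = simple₀ ; branching = Sym-branching branching₀ }

uncolourable₀ : ¬ Colouring (Sym E₀)
uncolourable₀ (_ , valid) =
  no-nonzero-triangle (λ ()) (λ ()) (λ ())
    (inj₁ (inj₁ e12)) (inj₁ (inj₁ e23)) (inj₂ (# 2 , inj₁ e12 , inj₁ e23))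
    (centre-nonzero claw₀-1) (centre-nonzero claw₀-2) (centre-nonzero claw₀-3)
  where open ColouringFacts simple₀ valid

simple₁ : IsSimple (Sym E₁)
simple₁ = Sym-isSimple λ ()

claw₁-1 : Claw (Sym E₁) (# 1) (# 0) (# 2) (# 8)
claw₁-1 = claw (inj₂ e01) (inj₁ e12) (inj₁ e18) (λ ()) (λ ()) (λ ())

claw₁-2 : Claw (Sym E₁) (# 2) (# 1) (# 3) (# 9)
claw₁-2 = claw (inj₂ e12) (inj₁ e23) (inj₁ e29) (λ ()) (λ ()) (λ ())

claw₁-5 : Claw (Sym E₁) (# 5) (# 6) (# 4) (# 10)
claw₁-5 = claw (inj₁ e56) (inj₂ e45) (inj₁ e510) (λ ()) (λ ()) (λ ())

claw₁-6 : Claw (Sym E₁) (# 6) (# 5) (# 7) (# 11)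
claw₁-6 = claw (inj₂ e56) (inj₁ e67) (inj₁ e611) (λ ()) (λ ()) (λ ())

branching₁-3-4 : BranchingAt (Sym E₁) (# 3) (# 4)
branching₁-3-4 _ _ _ (inj₁ e34) r≢4 = ⊥-elim (r≢4 refl)
branching₁-3-4 _ _ _ (inj₂ e23) _   = -, -, -, claw₁-2

branching₁-4-3 : BranchingAt (Sym E₁) (# 4) (# 3)
branching₁-4-3 _ _ _ (inj₁ e45) _   = -, -, -, claw₁-5
branching₁-4-3 _ _ _ (inj₂ e34) r≢3 = ⊥-elim (r≢3 refl)

branching₁ : ∀ {p q} → E₁ p q → BranchingAt (Sym E₁) p q × BranchingAt (Sym E₁) q p
branching₁ e01  = branchingAt-degree≥3-end (inj₂ (-, -, -, claw₁-1))
branching₁ e12  = branchingAt-degree≥3-end (inj₁ (-, -, -, claw₁-1))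
branching₁ e23  = branchingAt-degree≥3-end (inj₁ (-, -, -, claw₁-2))
branching₁ e34  = branching₁-3-4 , branching₁-4-3
branching₁ e45  = branchingAt-degree≥3-end (inj₂ (-, -, -, claw₁-5))
branching₁ e56  = branchingAt-degree≥3-end (inj₁ (-, -, -, claw₁-5))
branching₁ e67  = branchingAt-degree≥3-end (inj₁ (-, -, -, claw₁-6))
branching₁ e18  = branchingAt-degree≥3-end (inj₁ (-, -, -, claw₁-1))
branching₁ e29  = branchingAt-degree≥3-end (inj₁ (-, -, -, claw₁-2))
branching₁ e510 = branchingAt-degree≥3-end (inj₁ (-, -, -, claw₁-5))
branching₁ e611 = branchingAt-degree≥3-end (inj₁ (-, -, -, claw₁-6))

admissible₁ : Admissible (Sym E₁)
admissible₁ = record { isSimple = simple₁ ; branching = Sym-branching branching₁ }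

uncolourable₁ : ¬ Colouring (Sym E₁)
uncolourable₁ (_ , valid) =
  independent (inj₁ e34) (leg-zero claw₁-2 (centre-nonzero claw₁-1))
                         (leg-zero claw₁-5 (centre-nonzero claw₁-6))
  where open ColouringFacts simple₁ valid
        open ValidColouring valid

pattern u₁ = inj₂ f0
pattern u₂ = inj₂ (fs f0)
pattern u₃ = inj₂ (fs (fs f0))
pattern w  = inj₂ (fs (fs (fs f0)))

new-edge-from-old : ∀ {m} {u v x : Fin m} {t} → Sym (NewE u v) (inj₁ x) t →
                    (x ≡ u × t ≡ u₁) ⊎ (x ≡ v × t ≡ u₃)
new-edge-from-old (inj₁ uu1) = inj₁ (refl , refl)
new-edge-from-old (inj₂ u3v) = inj₂ (refl , refl)

module Expansion (G : Graph) (u v : Fin (n G)) (admissible : Admissible (Adj G))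
                 (uv : Adj G u v) (u-deg2 : Degree2 (Adj G) u) (v-deg2 : Degree2 (Adj G) v) where
  open Admissible admissible
  open IsSimple isSimple

  S : Set
  S = Fin (n G) ⊎ Fin 4

  AdjS : S → S → Set
  AdjS s t = OldKept G u v s t ⊎ Sym (NewE u v) s t

  expansion-iso : RelIso AdjS (Adj (Expand G u v))
  expansion-iso = record
    { to = join (n G) 4 ; from = splitAt (n G)
    ; from-to = splitAt-join (n G) 4 ; to-from = join-splitAt (n G) 4
    ; to-adj = λ {s} {t} → subst₂ AdjS (sym (splitAt-join (n G) 4 s)) (sym (splitAt-join (n G) 4 t))
    ; from-adj = λ e → e }

  open OtherNeighbour (other-neighbour {A = Adj G} u-deg2 uv)
    renaming (vertex to a; vertex≢ to a≢v; adjacent to ua; only to u-nbrs)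
  open OtherNeighbour (other-neighbour {A = Adj G} v-deg2 (symmetric uv))
    renaming (vertex to b; vertex≢ to b≢u; adjacent to vb; only to v-nbrs)

  u≢v : u ≢ v
  u≢v = adjacent⇒≢ uv

  a≢u : a ≢ u
  a≢u = adjacent⇒≢ ua ∘ sym

  b≢v : b ≢ v
  b≢v = adjacent⇒≢ vb ∘ sym

  inj₁≢ : ∀ {x y : Fin (n G)} → x ≢ y → inj₁ x ≢ (S ∋ inj₁ y)
  inj₁≢ x≢y = x≢y ∘ inj₁-injective

  lift-edge-from : ∀ {x y} → x ≢ u → x ≢ v → Adj G x y → AdjS (inj₁ x) (inj₁ y)
  lift-edge-from x≢u x≢v e = inj₁ (e , x≢u ∘ proj₁ , x≢v ∘ proj₁)

  lift-edge-off-v : ∀ {x y} → x ≢ v → y ≢ v → Adj G x y → AdjS (inj₁ x) (inj₁ y)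
  lift-edge-off-v x≢v y≢v e = inj₁ (e , y≢v ∘ proj₂ , x≢v ∘ proj₁)

  symmetricS : ∀ {s t} → AdjS s t → AdjS t s
  symmetricS {inj₁ _} {inj₁ _} (inj₁ (e , not-uv , not-vu)) =
    inj₁ (symmetric e , (λ (p , q) → not-vu (q , p)) , (λ (p , q) → not-uv (q , p)))
  symmetricS (inj₂ e) = inj₂ (swap e)

  irreflexiveS : ∀ {s} → ¬ AdjS s s
  irreflexiveS {inj₁ _} (inj₁ (e , _)) = irreflexive e
  irreflexiveS (inj₂ (inj₁ ()))
  irreflexiveS (inj₂ (inj₂ ()))

  simpleS : IsSimple AdjS
  simpleS = record { symmetric = symmetricS ; irreflexive = irreflexiveS }

  au-S : AdjS (inj₁ a) (inj₁ u)
  au-S = lift-edge-from a≢u a≢v (symmetric ua)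

  vb-S : AdjS (inj₁ v) (inj₁ b)
  vb-S = symmetricS (lift-edge-from b≢u b≢v (symmetric vb))

  old-neighbour : ∀ {x t} → x ≢ u → x ≢ v → AdjS (inj₁ x) t →
                  Σ (Fin (n G)) λ y → t ≡ inj₁ y × Adj G x y
  old-neighbour {t = inj₁ y} _ _ (inj₁ (e , _)) = y , refl , e
  old-neighbour {t = inj₂ _} _ _ (inj₁ ())
  old-neighbour x≢u x≢v (inj₂ e) with new-edge-from-old e
  ... | inj₁ (x≡u , _) = ⊥-elim (x≢u x≡u)
  ... | inj₂ (x≡v , _) = ⊥-elim (x≢v x≡v)

  neighbours-u : ∀ {t} → AdjS (inj₁ u) t → t ≡ u₁ ⊎ t ≡ inj₁ a
  neighbours-u {inj₁ z} (inj₁ (e , not-uv , _)) with u-nbrs z e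
  ... | inj₁ z≡a = inj₂ (cong inj₁ z≡a)
  ... | inj₂ z≡v = ⊥-elim (not-uv (refl , z≡v))
  neighbours-u {inj₂ _} (inj₁ ())
  neighbours-u (inj₂ e) with new-edge-from-old e
  ... | inj₁ (_ , t≡u₁) = inj₁ t≡u₁
  ... | inj₂ (u≡v , _)  = ⊥-elim (u≢v u≡v)

  neighbours-v : ∀ {t} → AdjS (inj₁ v) t → t ≡ u₃ ⊎ t ≡ inj₁ b
  neighbours-v {inj₁ z} (inj₁ (e , _ , not-vu)) with v-nbrs z e
  ... | inj₁ z≡b = inj₂ (cong inj₁ z≡b)
  ... | inj₂ z≡u = ⊥-elim (not-vu (refl , z≡u))
  neighbours-v {inj₂ _} (inj₁ ())
  neighbours-v (inj₂ e) with new-edge-from-old e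
  ... | inj₁ (v≡u , _)  = ⊥-elim (u≢v (sym v≡u))
  ... | inj₂ (_ , t≡u₃) = inj₁ t≡u₃

  neighbours-u₁ : ∀ {t} → AdjS u₁ t → t ≡ inj₁ u ⊎ t ≡ u₂
  neighbours-u₁ (inj₁ ())
  neighbours-u₁ (inj₂ (inj₁ u1u2)) = inj₂ refl
  neighbours-u₁ (inj₂ (inj₂ uu1))  = inj₁ refl

  neighbours-u₃ : ∀ {t} → AdjS u₃ t → t ≡ inj₁ v ⊎ t ≡ u₂
  neighbours-u₃ (inj₁ ())
  neighbours-u₃ (inj₂ (inj₁ u3v))  = inj₁ refl
  neighbours-u₃ (inj₂ (inj₂ u2u3)) = inj₂ refl

  neighbours-w : ∀ {t} → AdjS w t → t ≡ u₂
  neighbours-w (inj₁ ())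
  neighbours-w (inj₂ (inj₂ u2w)) = refl

  claw-u₂ : Claw AdjS u₂ u₁ u₃ w
  claw-u₂ = claw (inj₂ (inj₂ u1u2)) (inj₂ (inj₁ u2u3)) (inj₂ (inj₁ u2w)) (λ ()) (λ ()) (λ ())

  claw-u₂′ : Claw AdjS u₂ u₃ u₁ w
  claw-u₂′ = claw (inj₂ (inj₁ u2u3)) (inj₂ (inj₂ u1u2)) (inj₂ (inj₁ u2w)) (λ ()) (λ ()) (λ ())

  u₂≥3 : Degree≥3 AdjS u₂
  u₂≥3 = -, -, -, claw-u₂

  lift-degree≥3 : ∀ {x} → Degree≥3 (Adj G) x → Degree≥3 AdjS (inj₁ x)
  lift-degree≥3 {x} x≥3 with x ≟ u | x ≟ v
  ... | yes refl | _ = ⊥-elim (degree≥3⇒¬degree2 x≥3 u-deg2)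
  ... | _ | yes refl = ⊥-elim (degree≥3⇒¬degree2 x≥3 v-deg2)
  ... | no x≢u | no x≢v with x≥3
  ...   | y₁ , y₂ , y₃ , claw e₁ e₂ e₃ d₁₂ d₁₃ d₂₃ =
    inj₁ y₁ , inj₁ y₂ , inj₁ y₃ ,
    claw (lift-edge-from x≢u x≢v e₁) (lift-edge-from x≢u x≢v e₂) (lift-edge-from x≢u x≢v e₃)
         (inj₁≢ d₁₂) (inj₁≢ d₁₃) (inj₁≢ d₂₃)

  a≥3 : Degree≥3 AdjS (inj₁ a)
  a≥3 = lift-degree≥3 (branching uv u-deg2 v-deg2 a ua a≢v)

  b≥3 : Degree≥3 AdjS (inj₁ b)
  b≥3 = lift-degree≥3 (branching (symmetric uv) v-deg2 u-deg2 b vb b≢u)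

  degree2-in-G : ∀ {z} → Degree2 AdjS (inj₁ z) → Degree2 (Adj G) z
  degree2-in-G {z} dz with z ≟ u | z ≟ v
  ... | yes refl | _ = u-deg2
  ... | _ | yes refl = v-deg2
  ... | no z≢u | no z≢v with dz
  ...   | α , β , α≢β , zα , zβ , only
          with old-neighbour z≢u z≢v zα | old-neighbour z≢u z≢v zβ
  ...     | α′ , refl , zα′ | β′ , refl , zβ′ =
    α′ , β′ , α≢β ∘ cong inj₁ , zα′ , zβ′ ,
    λ y zy → map inj₁-injective inj₁-injective (only (inj₁ y) (lift-edge-from z≢u z≢v zy))

  branching-off-uv : ∀ {y q} → y ≢ u → y ≢ v → AdjS (inj₁ y) q → BranchingAt AdjS (inj₁ y) q
  branching-off-uv y≢u y≢v yq dy dq _ yr r≢q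
    with old-neighbour y≢u y≢v yq | old-neighbour y≢u y≢v yr
  ... | _ , refl , yz | x , refl , yx =
    lift-degree≥3 (branching yz (degree2-in-G dy) (degree2-in-G dq) x yx (r≢q ∘ cong inj₁))

  branchingS : Branching AdjS
  branchingS {u₁} = branchingAt-beside-degree≥3 neighbours-u₁ u₂≥3
  branchingS {u₂} _ du₂ = ⊥-elim (degree≥3⇒¬degree2 u₂≥3 du₂)
  branchingS {u₃} = branchingAt-beside-degree≥3 neighbours-u₃ u₂≥3
  branchingS {w} wq _ dq with neighbours-w wq
  ... | refl = ⊥-elim (degree≥3⇒¬degree2 u₂≥3 dq)
  branchingS {inj₁ y} with y ≟ u | y ≟ v
  ... | yes refl | _ = branchingAt-beside-degree≥3 neighbours-u a≥3
  ... | _ | yes refl = branchingAt-beside-degree≥3 neighbours-v b≥3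
  ... | no y≢u | no y≢v = branching-off-uv y≢u y≢v

  admissibleS : Admissible AdjS
  admissibleS = record { isSimple = simpleS ; branching = branchingS }

  module Restriction {c : S → Fin 3} (valid : ValidColouring AdjS c) where
    open ValidColouring valid
    open ColouringFacts simpleS valid using (centre-nonzero; opposite-of-zero; opposite-of-nonzero)

    b-nonzero : c (inj₁ b) ≢ f0
    b-nonzero = let (_ , _ , _ , claw-b) = b≥3 in centre-nonzero claw-b

    -- Keep c away from v and give v the colour p; the hypotheses are the constraints
    -- between pairs that are near in G but not in the expansion: u–v, u–b and v–a.
    module Recolouring (p : Fin 3) (p-choice : p ≡ c (inj₁ v) ⊎ p ≡ f0)
                       (uv-independent : c (inj₁ u) ≡ f0 → p ≢ f0)
                       (uv-compatible : Compatible (c (inj₁ u)) p)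
                       (ub-compatible : Compatible (c (inj₁ u)) (c (inj₁ b)))
                       (va-compatible : Compatible p (c (inj₁ a))) where

      recoloured : Fin (n G) → Fin 3
      recoloured x with x ≟ v
      ... | yes _ = p
      ... | no _  = c (inj₁ x)

      compatible-as-v : ∀ {q} → Compatible (c (inj₁ v)) q → Compatible p q
      compatible-as-v {q} ok = [ (λ p≡cv → subst (λ t → Compatible t q) (sym p≡cv) ok)
                               , (λ p≡0 _ → p≡0) ]′ p-choice

      independent-at-v : ∀ {y} → Adj G v y → p ≡ f0 → c (inj₁ y) ≡ f0 → ⊥
      independent-at-v vy with v-nbrs _ vy
      ... | inj₁ refl = λ _ → b-nonzero
      ... | inj₂ refl = λ p≡0 cu≡0 → uv-independent cu≡0 p≡0

      compatible-at-v : ∀ {y} → y ≢ v → Near (Adj G) v y → Compatible p (c (inj₁ y))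
      compatible-at-v y≢v (inj₁ vy) with v-nbrs _ vy
      ... | inj₁ refl = compatible-as-v (packing (inj₁≢ (y≢v ∘ sym)) (inj₁ vb-S))
      ... | inj₂ refl = compatible-sym uv-compatible
      compatible-at-v y≢v (inj₂ (m , vm , my)) with v-nbrs _ vm
      ... | inj₁ refl = compatible-as-v (packing (inj₁≢ (y≢v ∘ sym))
                          (inj₂ (inj₁ b , vb-S , lift-edge-from b≢u b≢v my)))
      ... | inj₂ refl with u-nbrs _ my
      ...   | inj₁ refl = va-compatible
      ...   | inj₂ refl = ⊥-elim (y≢v refl)

      compatible-off-v : ∀ {x y} → x ≢ v → y ≢ v → x ≢ y → Near (Adj G) x y →
                         Compatible (c (inj₁ x)) (c (inj₁ y))
      compatible-off-v x≢v y≢v x≢y (inj₁ xy) =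
        packing (inj₁≢ x≢y) (inj₁ (lift-edge-off-v x≢v y≢v xy))
      compatible-off-v x≢v y≢v x≢y (inj₂ (m , xm , my)) with m ≟ v
      ... | no m≢v = packing (inj₁≢ x≢y)
                       (inj₂ (inj₁ m , lift-edge-off-v x≢v m≢v xm , lift-edge-off-v m≢v y≢v my))
      ... | yes refl with v-nbrs _ (symmetric xm) | v-nbrs _ my
      ...   | inj₁ refl | inj₁ refl = ⊥-elim (x≢y refl)
      ...   | inj₁ refl | inj₂ refl = compatible-sym ub-compatible
      ...   | inj₂ refl | inj₁ refl = ub-compatible
      ...   | inj₂ refl | inj₂ refl = ⊥-elim (x≢y refl)

      recoloured-independent : ∀ {x y} → Adj G x y → recoloured x ≡ f0 → recoloured y ≡ f0 → ⊥
      recoloured-independent {x} {y} xy with x ≟ v | y ≟ v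
      ... | yes x≡v | yes y≡v = λ _ _ → irreflexive (subst₂ (Adj G) x≡v y≡v xy)
      ... | yes x≡v | no _    = independent-at-v (subst (λ t → Adj G t y) x≡v xy)
      ... | no _    | yes y≡v = λ cx≡0 p≡0 →
        independent-at-v (subst (λ t → Adj G t x) y≡v (symmetric xy)) p≡0 cx≡0
      ... | no x≢v  | no y≢v  = independent (lift-edge-off-v x≢v y≢v xy)

      recoloured-packing : ∀ {x y} → x ≢ y → Near (Adj G) x y →
                           Compatible (recoloured x) (recoloured y)
      recoloured-packing {x} {y} x≢y xy with x ≟ v | y ≟ v
      ... | yes x≡v | yes y≡v = ⊥-elim (x≢y (trans x≡v (sym y≡v)))
      ... | yes x≡v | no y≢v  = compatible-at-v y≢v (subst (λ t → Near (Adj G) t y) x≡v xy)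
      ... | no x≢v  | yes y≡v = compatible-sym (compatible-at-v x≢v
                                  (subst (λ t → Near (Adj G) t x) y≡v (near-sym {A = Adj G} symmetric xy)))
      ... | no x≢v  | no y≢v  = compatible-off-v x≢v y≢v x≢y xy

      colouring : Colouring (Adj G)
      colouring = recoloured , record { independent = recoloured-independent ; packing = recoloured-packing }

    u-zero : c (inj₁ u) ≡ f0 → c (inj₁ v) ≡ c u₁ × c (inj₁ v) ≢ f0
    u-zero = opposite-of-zero claw-u₂ (inj₂ (inj₁ uu1)) (inj₂ (inj₂ u3v)) (λ ())

    v-zero : c (inj₁ v) ≡ f0 → c (inj₁ u) ≡ c u₃ × c (inj₁ u) ≢ f0
    v-zero = opposite-of-zero claw-u₂′ (inj₂ (inj₂ u3v)) (inj₂ (inj₁ uu1)) (λ ())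

    va-compatible : c (inj₁ u) ≡ f0 → Compatible (c (inj₁ v)) (c (inj₁ a))
    va-compatible cu≡0 = subst (λ t → Compatible t (c (inj₁ a))) (sym (proj₁ (u-zero cu≡0)))
      (compatible-sym (packing (λ ()) (inj₂ (inj₁ u , au-S , inj₂ (inj₁ uu1)))))

    ub-compatible : c (inj₁ u) ≢ f0 → Compatible (c (inj₁ u)) (c (inj₁ b))
    ub-compatible cu≢0 with c (inj₁ v) ≟ f0
    ... | yes cv≡0 = subst (λ t → Compatible t (c (inj₁ b))) (sym (proj₁ (v-zero cv≡0)))
                       (packing (λ ()) (inj₂ (inj₁ v , inj₂ (inj₁ u3v) , vb-S)))
    ... | no cv≢0 = subst (λ t → Compatible t (c (inj₁ b)))
                      (sym (opposite-of-nonzero claw-u₂ (inj₂ (inj₁ uu1)) (inj₂ (inj₂ u3v))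
                              (λ ()) (λ ()) cu≢0 cv≢0))
                      (packing (inj₁≢ (b≢v ∘ sym)) (inj₁ vb-S))

    restriction : Colouring (Adj G)
    restriction with c (inj₁ u) ≟ f0
    ... | yes cu≡0 = Recolouring.colouring (c (inj₁ v)) (inj₁ refl) (λ _ → proj₂ (u-zero cu≡0))
                       (λ _ → cu≡0) (λ _ → cu≡0) (va-compatible cu≡0)
    ... | no cu≢0  = Recolouring.colouring f0 (inj₂ refl) (λ cu≡0 _ → cu≢0 cu≡0)
                       (λ cu≡0 → cu≡0) (ub-compatible cu≢0) (λ _ → refl)

  uncolourableS : ¬ Colouring (Adj G) → ¬ Colouring AdjS
  uncolourableS uncol (_ , valid) = uncol (Restriction.restriction valid)

colourable⇒colouring : ∀ G → Colorable122 G → Colouring (Adj G)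
colourable⇒colouring G (c , indep , packing₁ , packing₂) =
  c , record { independent = λ xy cx≡0 cy≡0 → indep _ _ cx≡0 cy≡0 xy ; packing = packing }
  where
  near⇒dist≤2 : ∀ {x y} → Near (Adj G) x y → DistLE G 2 x y
  near⇒dist≤2 (inj₁ xy)            = 1 , s≤s z≤n , step xy here
  near⇒dist≤2 (inj₂ (_ , xm , my)) = 2 , s≤s (s≤s z≤n) , step xm (step my here)

  packing : ∀ {x y} → x ≢ y → Near (Adj G) x y → Compatible (c x) (c y)
  packing {x} {y} x≢y xy cx≡cy with c x in cx
  ... | f0         = refl
  ... | fs f0      = ⊥-elim (packing₁ x y cx (sym cx≡cy) x≢y (near⇒dist≤2 xy))
  ... | fs (fs f0) = ⊥-elim (packing₂ x y cx (sym cx≡cy) x≢y (near⇒dist≤2 xy))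

admissible-and-uncolourable : ∀ {G} → InT G → Admissible (Adj G) × ¬ Colouring (Adj G)
admissible-and-uncolourable t0 = admissible₀ , uncolourable₀
admissible-and-uncolourable t1 = admissible₁ , uncolourable₁
admissible-and-uncolourable (ext {G} u v t uv u-deg2 v-deg2)
  with admissible-and-uncolourable t
... | admissible , uncolourable =
  transport-admissible expansion-iso admissibleS ,
  transport-uncolourable expansion-iso (uncolourableS uncolourable)
  where open Expansion G u v admissible uv u-deg2 v-deg2
admissible-and-uncolourable (iso t φ) with admissible-and-uncolourable t
... | admissible , uncolourable =
  transport-admissible (≅⇒RelIso φ) admissible , transport-uncolourable (≅⇒RelIso φ) uncolourable

lemma2p5 : (G : Graph) → InT G → ¬ Colorable122 G
lemma2p5 G t = proj₂ (admissible-and-uncolourable t) ∘ colourable⇒colouring G
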